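{- Let $G$ be a finite simple graph. Then $G$ is an EOCD graph with empty $P-D$ if and only if there exists $D\subseteq V(G)$ such that $\langle D\rangle$ is a matching $M$ (every vertex of $D$ has exactly one neighbor in $D$), every edge of $M$ has at least one endpoint of degree $1$ in $G$, and every vertex of $V(G)-D$ is adjacent to exactly one vertex of $D$.
   Context: For a vertex $v$, $N(v)$ and $N[v]=N(v)\cup\{v\}$ are its open and closed neighborhoods. A set $P\subseteq V(G)$ is an ECD set if the sets $N[v]$, $v\in P$, partition $V(G)$. A set $D\subseteq V(G)$ is an EOD set if the sets $N(v)$, $v\in D$, partition $V(G)$. $G$ is an EOCD graph if it has both an ECD set and an EOD set. $G$ is an EOCD graph with empty $P-D$ if there exist an ECD set $P$ and an EOD set $D$ of $G$ with $P\subseteq D$. $\langle S\rangle$ denotes the subgraph induced by $S$. -}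

module Defs where

open import Data.Nat using (ℕ)
open import Data.Fin using (Fin)
open import Data.Fin.Subset using (Subset; _∈_; _∉_; _⊆_)
open import Data.Product using (Σ; _×_)
open import Data.Sum using (_⊎_)
open import Relation.Nullary using (¬_; Dec)
open import Relation.Binary.PropositionalEquality using (_≡_)

record SimpleGraph (n : ℕ) : Set₁ where
  field
    Adj     : Fin n → Fin n → Set
    sym     : ∀ {u v} → Adj u v → Adj v u
    irrefl  : ∀ {v} → ¬ Adj v v
    adj-dec : ∀ u v → Dec (Adj u v)

open SimpleGraph public

ExactlyOne : {n : ℕ} → (Fin n → Set) → Set
ExactlyOne {n} P = Σ (Fin n) (λ v → P v × (∀ w → P w → w ≡ v))

module _ {n : ℕ} (G : SimpleGraph n) where

  InOpenNbhd : Fin n → Fin n → Set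
  InOpenNbhd u v = Adj G v u

  InClosedNbhd : Fin n → Fin n → Set
  InClosedNbhd u v = (u ≡ v) ⊎ Adj G v u

  IsECD : Subset n → Set
  IsECD P = ∀ u → ExactlyOne (λ v → (v ∈ P) × InClosedNbhd u v)

  IsEOD : Subset n → Set
  IsEOD D = ∀ u → ExactlyOne (λ v → (v ∈ D) × InOpenNbhd u v)

  EOCDEmptyPminusD : Set
  EOCDEmptyPminusD =
    Σ (Subset n) (λ P → Σ (Subset n) (λ D → IsECD P × IsEOD D × P ⊆ D))

  Degree1 : Fin n → Set
  Degree1 v = ExactlyOne (λ w → Adj G v w)

  InducesMatching : Subset n → Set
  InducesMatching D = ∀ v → v ∈ D → ExactlyOne (λ w → (w ∈ D) × Adj G v w)

  MatchingEdgesHaveLeaf : Subset n → Set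
  MatchingEdgesHaveLeaf D =
    ∀ u v → u ∈ D → v ∈ D → Adj G u v → Degree1 u ⊎ Degree1 v

  OutsideDominatedOnce : Subset n → Set
  OutsideDominatedOnce D = ∀ v → v ∉ D → ExactlyOne (λ w → (w ∈ D) × Adj G v w)

module Submission where

-- The three conditions on D together say exactly that every vertex has a
-- unique neighbour in D; by symmetry of adjacency this is the EOD property.
-- So the content lies in relating ECD sets inside D to the leaf condition.
--
-- (⇒) If u ∈ P ⊆ D and v ∈ D are adjacent, v has degree 1: any other
--     neighbour x of v would be covered by some p ∈ P, and either p = x
--     collides with u in N[v], or p is x's unique D-neighbour v, so v ∈ P
--     collides with u in N[v].  Covering an endpoint of a matching edge puts
--     one endpoint in P, so the other one is a leaf.
-- (⇐) From each matching edge choose one endpoint for P: an endpoint whose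
--     partner has all its neighbours in D, ties broken by the order on
--     Fin n (a general tie-breaking lemma).  A matched vertex with a neighbour
--     outside D is then always chosen, and P is an ECD set.

open import Defs
open import Data.Bool using (true)
open import Data.Nat using (ℕ)
open import Data.Fin using (Fin; _<_)
open import Data.Fin.Properties using (_<?_; <-cmp; <-asym; all?)
open import Data.Fin.Subset using (Subset; _∈_; _∉_)
open import Data.Fin.Subset.Properties using (_∈?_)
open import Data.Vec using (tabulate)
open import Data.Vec.Properties using (lookup∘tabulate; lookup⇒[]=; []=⇒lookup)
open import Data.Product using (Σ; _×_; _,_; proj₁; proj₂)
open import Data.Sum using (_⊎_; inj₁; inj₂; map; fromInj₁; fromInj₂)
open import Data.Empty using (⊥; ⊥-elim)
open import Relation.Nullary using (¬_; Dec; yes; no; does; contradiction)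
open import Relation.Nullary.Decidable using (dec-true; _×-dec_; _→-dec_)
open import Relation.Binary using (tri<; tri≈; tri>)
open import Relation.Binary.PropositionalEquality using (_≡_; _≢_; refl; trans; subst)
import Relation.Binary.PropositionalEquality as ≡
open import Function.Bundles using (_⇔_; mk⇔; module Equivalence)

exactlyOne-unique : ∀ {n} {P : Fin n → Set} → ExactlyOne P →
                    ∀ {a b} → P a → P b → a ≡ b
exactlyOne-unique (_ , _ , only) pa pb = trans (only _ pa) (≡.sym (only _ pb))

exactlyOne-cong : ∀ {n} {P Q : Fin n → Set} →
                  (∀ v → P v → Q v) → (∀ v → Q v → P v) →
                  ExactlyOne P → ExactlyOne Q
exactlyOne-cong P⇒Q Q⇒P (c , pc , only) = c , P⇒Q c pc , λ w qw → only w (Q⇒P w qw)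

⟦_⟧ : ∀ {n} {P : Fin n → Set} → (∀ v → Dec (P v)) → Subset n
⟦ P? ⟧ = tabulate (λ v → does (P? v))

∈⟦⟧⇒ : ∀ {n} {P : Fin n → Set} (P? : ∀ v → Dec (P v)) {v} → v ∈ ⟦ P? ⟧ → P v
∈⟦⟧⇒ P? {v} v∈ = witness (P? v) (trans (≡.sym (lookup∘tabulate _ v)) ([]=⇒lookup v∈))
  where
  witness : ∀ {A : Set} (A? : Dec A) → does A? ≡ true → A
  witness (yes a) _ = a

⇒∈⟦⟧ : ∀ {n} {P : Fin n → Set} (P? : ∀ v → Dec (P v)) {v} → P v → v ∈ ⟦ P? ⟧
⇒∈⟦⟧ P? {v} pv = lookup⇒[]= v _ (trans (lookup∘tabulate _ v) (dec-true (P? v) pv))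

Prefer : ∀ {n} → (Fin n → Set) → Fin n → Fin n → Set
Prefer L a b = L b × (L a → a < b)

prefer? : ∀ {n} {L : Fin n → Set} → (∀ v → Dec (L v)) → ∀ a b → Dec (Prefer L a b)
prefer? L? a b = L? b ×-dec (L? a →-dec (a <? b))

prefer-asym : ∀ {n} {L : Fin n → Set} {a b} → Prefer L a b → ¬ Prefer L b a
prefer-asym (Lb , a<b) (La , b<a) = <-asym (a<b La) (b<a Lb)

prefer-total : ∀ {n} {L : Fin n → Set} → (∀ v → Dec (L v)) →
               ∀ {a b} → a ≢ b → L a ⊎ L b → Prefer L a b ⊎ Prefer L b a
prefer-total L? {a} {b} a≢b La⊎Lb with <-cmp a b
... | tri≈ _ a≡b _ = ⊥-elim (a≢b a≡b)
... | tri< a<b _ _ with L? b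
...   | yes Lb = inj₁ (Lb , λ _ → a<b)
...   | no ¬Lb = inj₂ (fromInj₁ (λ Lb → contradiction Lb ¬Lb) La⊎Lb , λ Lb → contradiction Lb ¬Lb)
prefer-total L? {a} {b} a≢b La⊎Lb | tri> _ _ b<a with L? a
...   | yes La = inj₂ (La , λ _ → b<a)
...   | no ¬La = inj₁ (fromInj₂ (λ La → contradiction La ¬La) La⊎Lb , λ La → contradiction La ¬La)

module _ {n : ℕ} (G : SimpleGraph n) where

  UniqueNeighbourIn : Subset n → Set
  UniqueNeighbourIn D = ∀ u → ExactlyOne (λ w → w ∈ D × Adj G u w)

  unique⇔eod : ∀ {D} → UniqueNeighbourIn D ⇔ IsEOD G D
  unique⇔eod = mk⇔ (λ uniq u → exactlyOne-cong (λ _ → swap) (λ _ → swap) (uniq u))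
                   (λ eod u → exactlyOne-cong (λ _ → swap) (λ _ → swap) (eod u))
    where
    swap : ∀ {A : Set} {x y} → A × Adj G x y → A × Adj G y x
    swap (a , xy) = a , sym G xy

  unique⇔matching×outside : ∀ {D} →
    UniqueNeighbourIn D ⇔ (InducesMatching G D × OutsideDominatedOnce G D)
  unique⇔matching×outside {D} =
    mk⇔ (λ uniq → (λ v _ → uniq v) , (λ v _ → uniq v)) combine
    where
    combine : InducesMatching G D × OutsideDominatedOnce G D → UniqueNeighbourIn D
    combine (matching , outside) u with u ∈? D
    ... | yes u∈D = matching u u∈D
    ... | no  u∉D = outside u u∉D

  module Leaves {P D : Subset n} (ecd : IsECD G P) (uniq : UniqueNeighbourIn D)
                (P⊆D : ∀ {x} → x ∈ P → x ∈ D) where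

    nbr-of-P-is-leaf : ∀ {u v} → u ∈ P → v ∈ D → Adj G u v → Degree1 G v
    nbr-of-P-is-leaf {u} {v} u∈P v∈D uv = u , sym G uv , only
      where
      only : ∀ x → Adj G v x → x ≡ u
      only x vx with ecd x
      ... | p , (p∈P , inj₁ refl) , _ =
            exactlyOne-unique (ecd v) (p∈P , inj₂ (sym G vx)) (u∈P , inj₂ uv)
      ... | p , (p∈P , inj₂ px) , _ = ⊥-elim (irrefl G (subst (Adj G u) v≡u uv))
        where
        p≡v : p ≡ v
        p≡v = exactlyOne-unique (uniq x) (P⊆D p∈P , sym G px) (v∈D , sym G vx)
        v≡u : v ≡ u
        v≡u = exactlyOne-unique (ecd v) (subst (_∈ P) p≡v p∈P , inj₁ refl) (u∈P , inj₂ uv)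

    -- The vertex of P covering u is u itself or its matching partner v;
    -- in either case the other endpoint is a leaf.
    leaf : MatchingEdgesHaveLeaf G D
    leaf u v u∈D v∈D uv with ecd u
    ... | p , (p∈P , inj₁ refl) , _ = inj₂ (nbr-of-P-is-leaf p∈P v∈D uv)
    ... | p , (p∈P , inj₂ pu) , _ = inj₁ (nbr-of-P-is-leaf v∈P u∈D (sym G uv))
      where
      v∈P : v ∈ P
      v∈P = subst (_∈ P) (exactlyOne-unique (uniq u) (P⊆D p∈P , sym G pu) (v∈D , uv)) p∈P

  module Selection {D : Subset n} (uniq : UniqueNeighbourIn D)
                   (leaf : MatchingEdgesHaveLeaf G D) where

    partner : Fin n → Fin n
    partner u = proj₁ (uniq u)

    partner-∈ : ∀ u → partner u ∈ D
    partner-∈ u = proj₁ (proj₁ (proj₂ (uniq u)))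

    partner-adj : ∀ u → Adj G u (partner u)
    partner-adj u = proj₂ (proj₁ (proj₂ (uniq u)))

    partner-≢ : ∀ u → u ≢ partner u
    partner-≢ u u≡w = irrefl G (subst (Adj G u) (≡.sym u≡w) (partner-adj u))

    partner-unique : ∀ {u w} → w ∈ D → Adj G u w → w ≡ partner u
    partner-unique {u} {w} w∈D uw = proj₂ (proj₂ (uniq u)) w (w∈D , uw)

    NbhdInD : Fin n → Set
    NbhdInD v = ∀ x → Adj G v x → x ∈ D

    nbhdInD? : ∀ v → Dec (NbhdInD v)
    nbhdInD? v = all? (λ x → adj-dec G v x →-dec (x ∈? D))

    -- A leaf's only neighbour is its partner, which lies in D.
    leaf⇒nbhdInD : ∀ {v} → Degree1 G v → NbhdInD v
    leaf⇒nbhdInD {v} deg1 x vx =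
      subst (_∈ D) (exactlyOne-unique deg1 (partner-adj v) vx) (partner-∈ v)

    edge-has-nbhdInD : ∀ {a b} → a ∈ D → b ∈ D → Adj G a b → NbhdInD a ⊎ NbhdInD b
    edge-has-nbhdInD {a} {b} a∈D b∈D ab = map leaf⇒nbhdInD leaf⇒nbhdInD (leaf a b a∈D b∈D ab)

    Chosen : Fin n → Set
    Chosen v = v ∈ D × Prefer NbhdInD v (partner v)

    chosen? : ∀ v → Dec (Chosen v)
    chosen? v = (v ∈? D) ×-dec prefer? nbhdInD? v (partner v)

    P : Subset n
    P = ⟦ chosen? ⟧

    chosen : ∀ {v} → v ∈ P → Chosen v
    chosen = ∈⟦⟧⇒ chosen?

    choose : ∀ {a b} → a ∈ D → b ∈ D → Adj G a b → Prefer NbhdInD a b → a ∈ P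
    choose {a} a∈D b∈D ab pref =
      ⇒∈⟦⟧ chosen? (a∈D , subst (Prefer NbhdInD a) (partner-unique b∈D ab) pref)

    P⊆D : ∀ {v} → v ∈ P → v ∈ D
    P⊆D v∈P = proj₁ (chosen v∈P)

    -- Adjacent vertices of D are partners, so at most one of them is chosen.
    not-both-chosen : ∀ {a b} → a ∈ P → b ∈ P → Adj G a b → ⊥
    not-both-chosen a∈P b∈P ab = prefer-asym (prefers a∈P b∈P ab) (prefers b∈P a∈P (sym G ab))
      where
      prefers : ∀ {x y} → x ∈ P → y ∈ P → Adj G x y → Prefer NbhdInD x y
      prefers {x} x∈P y∈P xy =
        subst (Prefer NbhdInD x) (≡.sym (partner-unique (P⊆D y∈P) xy)) (proj₂ (chosen x∈P))

    -- A matched vertex with a neighbour outside D is chosen: its partner is the leaf.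
    open-is-chosen : ∀ {w} → w ∈ D → ¬ NbhdInD w → w ∈ P
    open-is-chosen {w} w∈D w-open =
      choose w∈D (partner-∈ w) (partner-adj w)
        ( fromInj₂ (λ w-nbhd → contradiction w-nbhd w-open)
                   (edge-has-nbhdInD w∈D (partner-∈ w) (partner-adj w))
        , λ w-nbhd → contradiction w-nbhd w-open)

    -- A vertex of D is covered by itself or by its partner, whichever is preferred.
    covered-in-D : ∀ {u} → u ∈ D → Σ (Fin n) (λ p → p ∈ P × InClosedNbhd G u p)
    covered-in-D {u} u∈D
      with prefer-total nbhdInD? (partner-≢ u) (edge-has-nbhdInD u∈D (partner-∈ u) (partner-adj u))
    ... | inj₁ u-first = u , choose u∈D (partner-∈ u) (partner-adj u) u-first , inj₁ refl
    ... | inj₂ partner-first =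
          partner u , choose (partner-∈ u) u∈D (sym G (partner-adj u)) partner-first
                    , inj₂ (sym G (partner-adj u))

    -- A vertex outside D is covered by its partner, which has u as a neighbour outside D.
    covered-outside-D : ∀ {u} → u ∉ D → Σ (Fin n) (λ p → p ∈ P × InClosedNbhd G u p)
    covered-outside-D {u} u∉D =
      partner u , open-is-chosen (partner-∈ u) (λ nbhd → u∉D (nbhd u (sym G (partner-adj u))))
                , inj₂ (sym G (partner-adj u))

    covered-once : ∀ {u a b} → a ∈ P × InClosedNbhd G u a → b ∈ P × InClosedNbhd G u b → a ≡ b
    covered-once (a∈P , inj₁ refl) (b∈P , inj₁ refl) = refl
    covered-once (a∈P , inj₁ refl) (b∈P , inj₂ bu) = ⊥-elim (not-both-chosen b∈P a∈P bu)
    covered-once (a∈P , inj₂ au) (b∈P , inj₁ refl) = ⊥-elim (not-both-chosen a∈P b∈P au)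
    covered-once {u} (a∈P , inj₂ au) (b∈P , inj₂ bu) =
      exactlyOne-unique (uniq u) (P⊆D a∈P , sym G au) (P⊆D b∈P , sym G bu)

    covered : ∀ u → Σ (Fin n) (λ p → p ∈ P × InClosedNbhd G u p)
    covered u with u ∈? D
    ... | yes u∈D = covered-in-D u∈D
    ... | no  u∉D = covered-outside-D u∉D

    ecd : IsECD G P
    ecd u = let (p , cover) = covered u in p , cover , λ _ cover′ → covered-once cover′ cover

proposition2p2 : (n : ℕ) (G : SimpleGraph n) →
    EOCDEmptyPminusD G ⇔
      Σ (Subset n) (λ D → InducesMatching G D × MatchingEdgesHaveLeaf G D × OutsideDominatedOnce G D)
proposition2p2 n G = mk⇔ forward backward
  where
  forward : EOCDEmptyPminusD G →
    Σ (Subset n) (λ D → InducesMatching G D × MatchingEdgesHaveLeaf G D × OutsideDominatedOnce G D)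
  forward (P , D , ecd , eod , P⊆D) = D , matching , Leaves.leaf G ecd uniq P⊆D , outside
    where
    uniq : UniqueNeighbourIn G D
    uniq = Equivalence.from (unique⇔eod G) eod
    open Σ (Equivalence.to (unique⇔matching×outside G) uniq)
      renaming (proj₁ to matching; proj₂ to outside)

  backward : Σ (Subset n) (λ D → InducesMatching G D × MatchingEdgesHaveLeaf G D × OutsideDominatedOnce G D) →
    EOCDEmptyPminusD G
  backward (D , matching , leaf , outside) = P , D , ecd , Equivalence.to (unique⇔eod G) uniq , P⊆D
    where
    uniq : UniqueNeighbourIn G D
    uniq = Equivalence.from (unique⇔matching×outside G) (matching , outside)
    open Selection G uniq leaf
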